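{- Let $\mathscr{D}=(\mathscr{P},\mathscr{B})$ be a $2$-$(cd,k,\lambda)$ design with integers $c,d\ge 2$, let $G\le\mathrm{Aut}(\mathscr{D})$ be transitive on $\mathscr{B}$ and leave invariant a partition $\mathscr{C}$ of $\mathscr{P}$ into $d$ classes of size $c$, with Delandtsheer--Doyen parameters $(m,n)$. Let $C\in\mathscr{C}$, $H=G_C^C$, $K=G^{\mathscr{C}}$. (a) If $m=1$ then $K$ is primitive on $\mathscr{C}$. (b) If $n=1$ then $H$ is primitive on $C$.
   Context: A $2$-$(v,k,\lambda)$ design has $v$ points, blocks which are $k$-subsets, every pair of distinct points in exactly $\lambda$ blocks. Inner pairs are unordered pairs of distinct points in the same class, outer pairs those in different classes. By Delandtsheer--Doyen there are positive integers $m,n$ with $c=(\binom{k}{2}-n)/m$, $d=(\binom{k}{2}-m)/n$, where $n$ is the number of inner pairs in a block and $mc$ the number of outer pairs in a block; these are the Delandtsheer--Doyen parameters. $G_C^C$ is the group induced on $C$ by its setwise stabiliser and $G^{\mathscr{C}}$ is the group induced on $\mathscr{C}$. -}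

module Defs where

open import Data.Nat using (ℕ; zero; suc; _+_; _*_; _≤_; _<ᵇ_)
open import Data.Bool using (Bool; true; false; if_then_else_; _∧_; not)
open import Data.Fin using (Fin; toℕ; _≟_)
import Data.Fin as F
open import Data.Fin.Subset using (Subset)
open import Data.Fin.Permutation using (Permutation′; _⟨$⟩ʳ_; _⟨$⟩ˡ_; id; flip; _∘ₚ_)
open import Data.Vec using (lookup; tabulate)
open import Data.Product using (Σ; _×_; ∃)
open import Data.Sum using (_⊎_)
open import Relation.Nullary using (¬_)
open import Relation.Nullary.Decidable using (⌊_⌋)
open import Relation.Binary.PropositionalEquality using (_≡_; _≢_)

countF : ∀ {n} → (Fin n → Bool) → ℕ
countF {zero} f = 0
countF {suc n} f = (if f F.zero then 1 else 0) + countF (λ i → f (F.suc i))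

sumF : ∀ {n} → (Fin n → ℕ) → ℕ
sumF {zero} f = 0
sumF {suc n} f = f F.zero + sumF (λ i → f (F.suc i))

pairCount : ∀ {v} → (Fin v → Fin v → Bool) → ℕ
pairCount P = sumF (λ x → countF (λ y → (toℕ x <ᵇ toℕ y) ∧ P x y))

record IsDesign (v k λ' b : ℕ) (B : Fin b → Subset v) : Set where
  field
    λ-pos       : 1 ≤ λ'
    blocks-size : ∀ i → countF (lookup (B i)) ≡ k
    blocks-dist : ∀ i j → B i ≡ B j → i ≡ j
    balanced    : ∀ x y → x ≢ y →
                  countF (λ i → lookup (B i) x ∧ lookup (B i) y) ≡ λ'

image : ∀ {v} → Permutation′ v → Subset v → Subset v
image g S = tabulate (λ y → lookup S (g ⟨$⟩ˡ y))

IsAut : ∀ {v b} → (Fin b → Subset v) → Permutation′ v → Set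
IsAut B g = ∀ i → ∃ λ j → image g (B i) ≡ B j

record IsAutSubgroup {v b} (B : Fin b → Subset v) (G : Permutation′ v → Set) : Set where
  field
    has-id  : G id
    has-∘   : ∀ g h → G g → G h → G (g ∘ₚ h)
    has-inv : ∀ g → G g → G (flip g)
    aut     : ∀ g → G g → IsAut B g

BlockTransitive : ∀ {v b} → (Fin b → Subset v) → (Permutation′ v → Set) → Set
BlockTransitive B G = ∀ i j → ∃ λ g → G g × (image g (B i) ≡ B j)

-- the partition of the points into the classes cls⁻¹(D), D : Fin d, each of size c
ClassSizes : ∀ {v d} → (Fin v → Fin d) → ℕ → Set
ClassSizes {v} {d} cls c = ∀ (D : Fin d) → countF (λ x → ⌊ cls x ≟ D ⌋) ≡ c

Invariant : ∀ {v d} → (Permutation′ v → Set) → (Fin v → Fin d) → Set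
Invariant G cls = ∀ g → G g → ∀ x y → cls x ≡ cls y → cls (g ⟨$⟩ʳ x) ≡ cls (g ⟨$⟩ʳ y)

innerPairs : ∀ {v d} → (Fin v → Fin d) → Subset v → ℕ
innerPairs cls S = pairCount (λ x y → lookup S x ∧ lookup S y ∧ ⌊ cls x ≟ cls y ⌋)

outerPairs : ∀ {v d} → (Fin v → Fin d) → Subset v → ℕ
outerPairs cls S = pairCount (λ x y → lookup S x ∧ lookup S y ∧ not ⌊ cls x ≟ cls y ⌋)

-- K = G^𝒞 is primitive on the set of classes 𝒞 = Fin d.
-- g ∈ G maps class D to class E iff some x with cls x = D has cls (g x) = E.
-- A partition of 𝒞 is given by a labelling p : Fin d → ℕ (parts = fibres);
-- it is K-invariant if g maps parts into parts; trivial = p injective or constant.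
KPrimitive : ∀ {v d} → (Permutation′ v → Set) → (Fin v → Fin d) → Set
KPrimitive {v} {d} G cls =
  (∀ (D E : Fin d) → ∃ λ g → G g × ∃ λ x → cls x ≡ D × cls (g ⟨$⟩ʳ x) ≡ E)
  × (∀ (p : Fin d → ℕ) →
       (∀ g → G g → ∀ x y → p (cls x) ≡ p (cls y) →
            p (cls (g ⟨$⟩ʳ x)) ≡ p (cls (g ⟨$⟩ʳ y))) →
       (∀ D E → p D ≡ p E → D ≡ E) ⊎ (∀ D E → p D ≡ p E))

Stab : ∀ {v d} → (Permutation′ v → Set) → (Fin v → Fin d) → Fin d → Permutation′ v → Set
Stab G cls C g = G g × (∀ x → cls x ≡ C → cls (g ⟨$⟩ʳ x) ≡ C)

-- H = G_C^C is primitive on C = cls⁻¹(C): transitive, and every H-invariant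
-- partition of C (labelling p restricted to C) is trivial
HPrimitive : ∀ {v d} → (Permutation′ v → Set) → (Fin v → Fin d) → Fin d → Set
HPrimitive {v} {d} G cls C =
  (∀ x y → cls x ≡ C → cls y ≡ C → ∃ λ g → Stab G cls C g × (g ⟨$⟩ʳ x ≡ y))
  × (∀ (p : Fin v → ℕ) →
       (∀ g → Stab G cls C g → ∀ x y → cls x ≡ C → cls y ≡ C → p x ≡ p y →
            p (g ⟨$⟩ʳ x) ≡ p (g ⟨$⟩ʳ y)) →
       (∀ x y → cls x ≡ C → cls y ≡ C → p x ≡ p y → x ≡ y)
       ⊎ (∀ x y → cls x ≡ C → cls y ≡ C → p x ≡ p y))

-- Everything rests on double counting pairs of points inside blocks.  Block's lemma: if
-- k ≠ v, let O be the orbit of a point under the group generated by elements carrying one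
-- block onto the others; counting pairs of distinct points starting in O, starting outside
-- O, and crossing from O to its complement gives three equations that force O to be
-- everything, so G is point-transitive.  For a G-invariant partition into classes of size s,
-- counting inner and outer pairs gives b·2i = λv(s−1) and b·2o = λv(v−s), hence
-- o(s−1) = i(v−s) and, as s ∣ v, s ∣ o.
-- (a) A K-invariant partition of 𝒞 is a G-invariant partition coarser than 𝒞; if it is not
--     universal then s ≤ o ≤ mc = c, so it is 𝒞 itself.
-- (b) Elements of G carrying each class onto C transport an H-invariant partition of C to a
--     G-invariant refinement of 𝒞 with at most n = 1 inner pair per block; the ratio then
--     forces its classes to be single points or whole classes.
-- The hypotheses also exclude k = v: a full block has too many inner and outer pairs.

module Submission where

open import Defs
import Algebra.Properties.Semiring.Sum as SemiringSum
open import Data.Bool using (Bool; true; false; if_then_else_; _∧_; _∨_; not) renaming (_≟_ to _≟ᴮ_)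
open import Data.Bool.Properties using (∧-conicalʳ; ∧-assoc; ∧-identityʳ; ∧-zeroʳ; ∧-inverseʳ; ∨-zeroʳ; not-injective)
open import Data.Empty using (⊥-elim)
open import Data.Fin using (Fin; toℕ; _≟_) renaming (zero to fzero; suc to fsuc)
open import Data.Fin.Permutation using (Permutation′; _⟨$⟩ʳ_; _⟨$⟩ˡ_; id; flip; _∘ₚ_; inverseˡ; inverseʳ)
open import Data.Fin.Properties using (any?; toℕ<n)
open import Data.Fin.Subset using (Subset)
import Data.Nat as ℕ
open import Data.Nat using (ℕ; zero; suc; _+_; _*_; _∸_; _≤_; _<_; _≤?_; z≤n; s≤s; _<ᵇ_;
  NonZero; >-nonZero; >-nonZero⁻¹; ≢-nonZero; ≢-nonZero⁻¹)
open import Data.Nat.Divisibility using (_∣_; _∣0; ∣-refl; ∣m∣n⇒∣m+n; ∣m+n∣m⇒∣n; ∣n⇒∣m*n; ∣⇒≤)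
open import Data.Nat.Properties hiding (_≟_)
open import Data.Nat.Tactic.RingSolver using (solve-∀)
open import Data.Product using (Σ; _×_; ∃; _,_; proj₁; proj₂)
open import Data.Product.Properties using (≡-dec)
open import Data.Sum using (_⊎_; inj₁; inj₂; [_,_]′)
open import Data.Vec using (lookup)
open import Data.Vec.Properties using (lookup∘tabulate)
open import Function using (_∘_)
open import Function.Bundles using (mk⇔)
open import Relation.Binary.Definitions using (DecidableEquality)
open import Relation.Binary.PropositionalEquality
open import Relation.Nullary using (Dec; yes; no)
open import Relation.Nullary.Decidable using (⌊_⌋; does; dec-true; dec-false; _⊎-dec_; does-⇔)

𝟙 : Bool → ℕ
𝟙 b = if b then 1 else 0

_⊆ᵇ_ : ∀ {n} → (Fin n → Bool) → (Fin n → Bool) → Set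
f ⊆ᵇ g = ∀ x → f x ≡ true → g x ≡ true

-- Uses does rather than ⌊_⌋: only does computes through suc x ≟ suc y (see countF-single).
_≢ᵇ_ : ∀ {n} → Fin n → Fin n → Bool
x ≢ᵇ y = not (does (x ≟ y))

⌊⌋-sound : ∀ {a} {A : Set a} (a? : Dec A) → ⌊ a? ⌋ ≡ true → A
⌊⌋-sound (yes a) _ = a

⌊⌋-complete : ∀ {a} {A : Set a} (a? : Dec A) → A → ⌊ a? ⌋ ≡ true
⌊⌋-complete (yes _) _ = refl
⌊⌋-complete (no ¬a) a = ⊥-elim (¬a a)

bool-ext : ∀ {a c} → (a ≡ true → c ≡ true) → (c ≡ true → a ≡ true) → a ≡ c
bool-ext {true} a⇒c c⇒a = sym (a⇒c refl)
bool-ext {false} {true} a⇒c c⇒a = c⇒a refl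
bool-ext {false} {false} a⇒c c⇒a = refl

∧∧-mono : ∀ {a c r r′} → (r ≡ true → r′ ≡ true) → (a ∧ c ∧ r) ≡ true → (a ∧ c ∧ r′) ≡ true
∧∧-mono {true} {true} r⇒r′ = r⇒r′

not-mono : ∀ {r r′} → (r′ ≡ true → r ≡ true) → not r ≡ true → not r′ ≡ true
not-mono {false} {false} _ _ = refl
not-mono {false} {true} r′⇒r _ with () ← r′⇒r refl

≢ᵇ⇒≢ : ∀ {n} {x y : Fin n} → x ≢ᵇ y ≡ true → x ≢ y
≢ᵇ⇒≢ {x = x} x≢ᵇx refl with () ← trans (sym x≢ᵇx) (cong not (dec-true (x ≟ x) refl))

≢ᵇ-permute : ∀ {v} (g : Permutation′ v) x y → (g ⟨$⟩ʳ x) ≢ᵇ (g ⟨$⟩ʳ y) ≡ x ≢ᵇ y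
≢ᵇ-permute g x y = cong not (does-⇔ (mk⇔ injective (cong (g ⟨$⟩ʳ_))) (g ⟨$⟩ʳ x ≟ g ⟨$⟩ʳ y) (x ≟ y))
  where
  injective : g ⟨$⟩ʳ x ≡ g ⟨$⟩ʳ y → x ≡ y
  injective gx≡gy = trans (sym (inverseˡ g)) (trans (cong (g ⟨$⟩ˡ_) gx≡gy) (inverseˡ g))

module ΣSum = SemiringSum +-*-semiring

sumF≡sum : ∀ {n} (f : Fin n → ℕ) → sumF f ≡ ΣSum.sum f
sumF≡sum {zero} f = refl
sumF≡sum {suc n} f = cong (f fzero +_) (sumF≡sum (f ∘ fsuc))

sumF-cong : ∀ {n} {f g : Fin n → ℕ} → (∀ i → f i ≡ g i) → sumF f ≡ sumF g
sumF-cong {zero} eq = refl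
sumF-cong {suc n} eq = cong₂ _+_ (eq fzero) (sumF-cong (eq ∘ fsuc))

sumF-mono : ∀ {n} {f g : Fin n → ℕ} → (∀ i → f i ≤ g i) → sumF f ≤ sumF g
sumF-mono {zero} le = z≤n
sumF-mono {suc n} le = +-mono-≤ (le fzero) (sumF-mono (le ∘ fsuc))

sumF-const : ∀ n (a : ℕ) → sumF {n} (λ _ → a) ≡ n * a
sumF-const zero a = refl
sumF-const (suc n) a = cong (a +_) (sumF-const n a)

sumF-+ : ∀ {n} (f g : Fin n → ℕ) → sumF (λ i → f i + g i) ≡ sumF f + sumF g
sumF-+ f g = begin
  sumF (λ i → f i + g i)       ≡⟨ sumF≡sum (λ i → f i + g i) ⟩
  ΣSum.sum (λ i → f i + g i)   ≡⟨ ΣSum.∑-distrib-+ f g ⟩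
  ΣSum.sum f + ΣSum.sum g      ≡⟨ sym (cong₂ _+_ (sumF≡sum f) (sumF≡sum g)) ⟩
  sumF f + sumF g              ∎
  where open ≡-Reasoning

sumF-*ˡ : ∀ {n} (a : ℕ) (f : Fin n → ℕ) → sumF (λ i → a * f i) ≡ a * sumF f
sumF-*ˡ a f = begin
  sumF (λ i → a * f i)       ≡⟨ sumF≡sum (λ i → a * f i) ⟩
  ΣSum.sum (λ i → a * f i)   ≡⟨ sym (ΣSum.*-distribˡ-sum a f) ⟩
  a * ΣSum.sum f             ≡⟨ cong (a *_) (sym (sumF≡sum f)) ⟩
  a * sumF f                 ∎
  where open ≡-Reasoning

sumF-*ʳ : ∀ {n} (a : ℕ) (f : Fin n → ℕ) → sumF (λ i → f i * a) ≡ sumF f * a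
sumF-*ʳ a f = trans (sumF-cong (λ i → *-comm (f i) a)) (trans (sumF-*ˡ a f) (*-comm a (sumF f)))

sumF-comm : ∀ {m n} (f : Fin m → Fin n → ℕ) →
  sumF (λ i → sumF (f i)) ≡ sumF (λ j → sumF (λ i → f i j))
sumF-comm f = begin
  sumF (λ i → sumF (f i))                 ≡⟨ sumF-cong (λ i → sumF≡sum (f i)) ⟩
  sumF (λ i → ΣSum.sum (f i))             ≡⟨ sumF≡sum (λ i → ΣSum.sum (f i)) ⟩
  ΣSum.sum (λ i → ΣSum.sum (f i))         ≡⟨ ΣSum.∑-comm f ⟩
  ΣSum.sum (λ j → ΣSum.sum (λ i → f i j)) ≡⟨ sym (sumF≡sum (λ j → ΣSum.sum (λ i → f i j))) ⟩
  sumF (λ j → ΣSum.sum (λ i → f i j))     ≡⟨ sumF-cong (λ j → sym (sumF≡sum (λ i → f i j))) ⟩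
  sumF (λ j → sumF (λ i → f i j))         ∎
  where open ≡-Reasoning

sumF-permute : ∀ {n} (π : Permutation′ n) (f : Fin n → ℕ) → sumF f ≡ sumF (f ∘ (π ⟨$⟩ʳ_))
sumF-permute π f = begin
  sumF f                          ≡⟨ sumF≡sum f ⟩
  ΣSum.sum f                      ≡⟨ ΣSum.sum-permute f π ⟩
  ΣSum.sum (f ∘ (π ⟨$⟩ʳ_))        ≡⟨ sym (sumF≡sum (f ∘ (π ⟨$⟩ʳ_))) ⟩
  sumF (f ∘ (π ⟨$⟩ʳ_))            ∎
  where open ≡-Reasoning

countF≡sumF : ∀ {n} (f : Fin n → Bool) → countF f ≡ sumF (𝟙 ∘ f)
countF≡sumF {zero} f = refl
countF≡sumF {suc n} f = cong (𝟙 (f fzero) +_) (countF≡sumF (f ∘ fsuc))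

countF-cong : ∀ {n} {f g : Fin n → Bool} → (∀ x → f x ≡ g x) → countF f ≡ countF g
countF-cong {zero} eq = refl
countF-cong {suc n} eq = cong₂ (λ a m → 𝟙 a + m) (eq fzero) (countF-cong (eq ∘ fsuc))

countF-mono : ∀ {n} {f g : Fin n → Bool} → f ⊆ᵇ g → countF f ≤ countF g
countF-mono {zero} f⊆g = z≤n
countF-mono {suc n} {f} {g} f⊆g = +-mono-≤ (𝟙-mono (f fzero) (g fzero) (f⊆g fzero)) (countF-mono (f⊆g ∘ fsuc))
  where
  𝟙-mono : ∀ a b → (a ≡ true → b ≡ true) → 𝟙 a ≤ 𝟙 b
  𝟙-mono true b a⇒b rewrite a⇒b refl = ≤-refl
  𝟙-mono false b _ = z≤n

countF≤ : ∀ {n} (f : Fin n → Bool) → countF f ≤ n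
countF≤ {zero} f = z≤n
countF≤ {suc n} f = +-mono-≤ (𝟙≤1 (f fzero)) (countF≤ (f ∘ fsuc))
  where
  𝟙≤1 : ∀ b → 𝟙 b ≤ 1
  𝟙≤1 true = s≤s z≤n
  𝟙≤1 false = z≤n

countF-true : ∀ n → countF {n} (λ _ → true) ≡ n
countF-true zero = refl
countF-true (suc n) = cong suc (countF-true n)

countF-false : ∀ n → countF {n} (λ _ → false) ≡ 0
countF-false zero = refl
countF-false (suc n) = countF-false n

countF-permute : ∀ {n} (π : Permutation′ n) (f : Fin n → Bool) → countF f ≡ countF (f ∘ (π ⟨$⟩ʳ_))
countF-permute π f = begin
  countF f                      ≡⟨ countF≡sumF f ⟩
  sumF (𝟙 ∘ f)                  ≡⟨ sumF-permute π (𝟙 ∘ f) ⟩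
  sumF (𝟙 ∘ f ∘ (π ⟨$⟩ʳ_))      ≡⟨ sym (countF≡sumF (f ∘ (π ⟨$⟩ʳ_))) ⟩
  countF (f ∘ (π ⟨$⟩ʳ_))        ∎
  where open ≡-Reasoning

countF-split : ∀ {n} (f q : Fin n → Bool) →
  countF f ≡ countF (λ x → f x ∧ q x) + countF (λ x → f x ∧ not (q x))
countF-split f q = begin
  countF f                                              ≡⟨ countF≡sumF f ⟩
  sumF (𝟙 ∘ f)                                          ≡⟨ sumF-cong (λ x → 𝟙-split (f x) (q x)) ⟩
  sumF (λ x → 𝟙 (f x ∧ q x) + 𝟙 (f x ∧ not (q x)))      ≡⟨ sumF-+ (λ x → 𝟙 (f x ∧ q x)) (λ x → 𝟙 (f x ∧ not (q x))) ⟩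
  sumF (λ x → 𝟙 (f x ∧ q x)) + sumF (λ x → 𝟙 (f x ∧ not (q x)))
    ≡⟨ sym (cong₂ _+_ (countF≡sumF (λ x → f x ∧ q x)) (countF≡sumF (λ x → f x ∧ not (q x)))) ⟩
  countF (λ x → f x ∧ q x) + countF (λ x → f x ∧ not (q x)) ∎
  where
  open ≡-Reasoning
  𝟙-split : ∀ a b → 𝟙 a ≡ 𝟙 (a ∧ b) + 𝟙 (a ∧ not b)
  𝟙-split true true = refl
  𝟙-split true false = refl
  𝟙-split false b = refl

countF-single : ∀ {n} (f : Fin n → Bool) x → countF (λ y → f y ∧ does (x ≟ y)) ≡ 𝟙 (f x)
countF-single {suc n} f fzero =
  trans (cong₂ _+_ (cong 𝟙 (∧-identityʳ (f fzero)))
                   (trans (countF-cong (λ y → ∧-zeroʳ (f (fsuc y)))) (countF-false n)))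
        (+-identityʳ (𝟙 (f fzero)))
countF-single {suc n} f (fsuc x) =
  cong₂ _+_ (cong 𝟙 (∧-zeroʳ (f fzero))) (countF-single (f ∘ fsuc) x)

countF-remove : ∀ {n} (f : Fin n → Bool) {x} → f x ≡ true →
  countF (λ y → f y ∧ x ≢ᵇ y) ≡ countF f ∸ 1
countF-remove f {x} fx = begin
  countF (λ y → f y ∧ x ≢ᵇ y)                                ≡⟨ sym (m+n∸m≡n 1 _) ⟩
  1 + countF (λ y → f y ∧ x ≢ᵇ y) ∸ 1                        ≡⟨ cong (λ m → m + countF (λ y → f y ∧ x ≢ᵇ y) ∸ 1) one ⟩
  countF (λ y → f y ∧ does (x ≟ y)) + countF (λ y → f y ∧ x ≢ᵇ y) ∸ 1
    ≡⟨ cong (_∸ 1) (sym (countF-split f (λ y → does (x ≟ y)))) ⟩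
  countF f ∸ 1                                               ∎
  where
  open ≡-Reasoning
  one : 1 ≡ countF (λ y → f y ∧ does (x ≟ y))
  one = sym (trans (countF-single f x) (cong 𝟙 fx))

countF-pos : ∀ {n} (f : Fin n → Bool) {x} → f x ≡ true → 1 ≤ countF f
countF-pos f {fzero} fx rewrite fx = s≤s z≤n
countF-pos f {fsuc x} fx = ≤-trans (countF-pos (f ∘ fsuc) fx) (m≤n+m _ (𝟙 (f fzero)))

countF-witness : ∀ {n} (f : Fin n → Bool) → 1 ≤ countF f → ∃ λ x → f x ≡ true
countF-witness {suc n} f pos with f fzero in e
... | true = fzero , e
... | false with countF-witness (f ∘ fsuc) pos
...   | x , fx = fsuc x , fx

countF≡0 : ∀ {n} (f : Fin n → Bool) → countF f ≡ 0 → ∀ x → f x ≡ false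
countF≡0 f none x with f x in e
... | false = refl
... | true with () ← subst (1 ≤_) none (countF-pos f e)

countF-strict : ∀ {n} {f g : Fin n → Bool} → f ⊆ᵇ g →
  ∀ {x} → f x ≡ false → g x ≡ true → suc (countF f) ≤ countF g
countF-strict {f = f} {g} f⊆g {x} fx gx = begin
  suc (countF f)                                        ≡⟨ +-comm 1 (countF f) ⟩
  countF f + 1                                          ≤⟨ +-mono-≤ (≤-reflexive (countF-cong g∧f≗f)) new ⟩
  countF (λ y → g y ∧ f y) + countF (λ y → g y ∧ not (f y)) ≡⟨ sym (countF-split g f) ⟩
  countF g                                              ∎
  where
  open ≤-Reasoning
  g∧f≗f : ∀ y → f y ≡ g y ∧ f y
  g∧f≗f y with f y in e
  ... | true rewrite f⊆g y e = refl
  ... | false = sym (∧-zeroʳ (g y))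
  new : 1 ≤ countF (λ y → g y ∧ not (f y))
  new = countF-pos (λ y → g y ∧ not (f y)) (cong₂ (λ a b → a ∧ not b) gx fx)

countF≤⇒⊇ᵇ : ∀ {n} {f g : Fin n → Bool} → f ⊆ᵇ g → countF g ≤ countF f → g ⊆ᵇ f
countF≤⇒⊇ᵇ {f = f} f⊆g g≤f x gx with f x in e
... | true = refl
... | false = ⊥-elim (<⇒≱ (countF-strict f⊆g e gx) g≤f)

countF≤1⇒unique : ∀ {n} (f : Fin n → Bool) → countF f ≤ 1 →
  ∀ {x y} → f x ≡ true → f y ≡ true → x ≡ y
countF≤1⇒unique f atMostOne {x} {y} fx fy with x ≟ y
... | yes x≡y = x≡y
... | no x≢y = ⊥-elim (<⇒≱ (countF-pos (λ z → f z ∧ x ≢ᵇ z) fy∧x≢y) others≤0)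
  where
  fy∧x≢y : (f y ∧ x ≢ᵇ y) ≡ true
  fy∧x≢y = cong₂ (λ a b → a ∧ not b) fy (dec-false (x ≟ y) x≢y)
  others≤0 : countF (λ z → f z ∧ x ≢ᵇ z) ≤ 0
  others≤0 = subst (_≤ 0) (sym (countF-remove f fx)) (∸-monoˡ-≤ 1 atMostOne)

orderedPairs : ∀ {v} → (Fin v → Fin v → Bool) → ℕ
orderedPairs W = sumF (λ x → countF (W x))

pairsIn : ∀ {v} → (Fin v → Bool) → (Fin v → Fin v → Bool) → ℕ
pairsIn T W = orderedPairs (λ x y → T x ∧ T y ∧ W x y)

orderedPairs≡sumF² : ∀ {v} (W : Fin v → Fin v → Bool) →
  orderedPairs W ≡ sumF (λ x → sumF (λ y → 𝟙 (W x y)))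
orderedPairs≡sumF² W = sumF-cong (λ x → countF≡sumF (W x))

orderedPairs-cong : ∀ {v} {W W′ : Fin v → Fin v → Bool} →
  (∀ x y → W x y ≡ W′ x y) → orderedPairs W ≡ orderedPairs W′
orderedPairs-cong eq = sumF-cong (λ x → countF-cong (eq x))

orderedPairs-permute : ∀ {v} (π : Permutation′ v) (W : Fin v → Fin v → Bool) →
  orderedPairs W ≡ orderedPairs (λ x y → W (π ⟨$⟩ʳ x) (π ⟨$⟩ʳ y))
orderedPairs-permute π W =
  trans (sumF-permute π (λ x → countF (W x)))
        (sumF-cong (λ x → countF-permute π (W (π ⟨$⟩ʳ x))))

orderedPairs-constRows : ∀ {v} (W : Fin v → Fin v → Bool) {r} →
  (∀ x → countF (W x) ≡ r) → orderedPairs W ≡ v * r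
orderedPairs-constRows {v} W {r} rows = trans (sumF-cong rows) (sumF-const v r)

orderedPairs-rows : ∀ {v} (W : Fin v → Fin v → Bool) (R : Fin v → Bool) r →
  (∀ x → countF (W x) ≡ 𝟙 (R x) * r) → orderedPairs W ≡ countF R * r
orderedPairs-rows W R r rows = begin
  sumF (λ x → countF (W x))     ≡⟨ sumF-cong rows ⟩
  sumF (λ x → 𝟙 (R x) * r)      ≡⟨ sumF-*ʳ r (𝟙 ∘ R) ⟩
  sumF (𝟙 ∘ R) * r              ≡⟨ cong (_* r) (sym (countF≡sumF R)) ⟩
  countF R * r                  ∎
  where open ≡-Reasoning

pairsIn-fromSet : ∀ {v} (T Q : Fin v → Bool) →
  pairsIn T (λ x y → Q x ∧ x ≢ᵇ y) ≡ countF (λ x → T x ∧ Q x) * (countF T ∸ 1)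
pairsIn-fromSet {v} T Q = orderedPairs-rows (λ x y → T x ∧ T y ∧ Q x ∧ x ≢ᵇ y) (λ x → T x ∧ Q x) (countF T ∸ 1) row
  where
  row : ∀ x → countF (λ y → T x ∧ T y ∧ Q x ∧ x ≢ᵇ y) ≡ 𝟙 (T x ∧ Q x) * (countF T ∸ 1)
  row x with T x in Tx | Q x
  ... | false | _     = countF-false v
  ... | true  | false = trans (countF-cong (λ y → ∧-zeroʳ (T y))) (countF-false v)
  ... | true  | true  = trans (countF-remove T Tx) (sym (+-identityʳ (countF T ∸ 1)))

pairsIn-acrossSet : ∀ {v} (T Q : Fin v → Bool) →
  pairsIn T (λ x y → Q x ∧ not (Q y)) ≡
  countF (λ x → T x ∧ Q x) * countF (λ y → T y ∧ not (Q y))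
pairsIn-acrossSet {v} T Q = orderedPairs-rows (λ x y → T x ∧ T y ∧ Q x ∧ not (Q y)) (λ x → T x ∧ Q x) _ row
  where
  row : ∀ x → countF (λ y → T x ∧ T y ∧ Q x ∧ not (Q y)) ≡
              𝟙 (T x ∧ Q x) * countF (λ y → T y ∧ not (Q y))
  row x with T x | Q x
  ... | false | _     = countF-false v
  ... | true  | false = trans (countF-cong (λ y → ∧-zeroʳ (T y))) (countF-false v)
  ... | true  | true  = sym (+-identityʳ _)

orderedPairs-halves : ∀ {v} (P : Fin v → Fin v → Bool) → (∀ x y → P x y ≡ P y x) →
  orderedPairs (λ x y → P x y ∧ x ≢ᵇ y) ≡ pairCount P + pairCount P
orderedPairs-halves P P-sym = begin
  orderedPairs (λ x y → P x y ∧ x ≢ᵇ y)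
    ≡⟨ orderedPairs≡sumF² (λ x y → P x y ∧ x ≢ᵇ y) ⟩
  sumF (λ x → sumF (λ y → 𝟙 (P x y ∧ x ≢ᵇ y)))
    ≡⟨ sumF-cong (λ x → sumF-cong (λ y → split x y)) ⟩
  sumF (λ x → sumF (λ y → 𝟙 (x <ᶠ y ∧ P x y) + 𝟙 (y <ᶠ x ∧ P y x)))
    ≡⟨ sumF-cong (λ x → sumF-+ (λ y → 𝟙 (x <ᶠ y ∧ P x y)) (λ y → 𝟙 (y <ᶠ x ∧ P y x))) ⟩
  sumF (λ x → sumF (λ y → 𝟙 (x <ᶠ y ∧ P x y)) + sumF (λ y → 𝟙 (y <ᶠ x ∧ P y x)))
    ≡⟨ sumF-+ (λ x → sumF (λ y → 𝟙 (x <ᶠ y ∧ P x y))) (λ x → sumF (λ y → 𝟙 (y <ᶠ x ∧ P y x))) ⟩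
  sumF (λ x → sumF (λ y → 𝟙 (x <ᶠ y ∧ P x y))) + sumF (λ x → sumF (λ y → 𝟙 (y <ᶠ x ∧ P y x)))
    ≡⟨ cong (sumF (λ x → sumF (λ y → 𝟙 (x <ᶠ y ∧ P x y))) +_) (sumF-comm (λ x y → 𝟙 (y <ᶠ x ∧ P y x))) ⟩
  sumF (λ x → sumF (λ y → 𝟙 (x <ᶠ y ∧ P x y))) + sumF (λ y → sumF (λ x → 𝟙 (y <ᶠ x ∧ P y x)))
    ≡⟨ sym (cong₂ _+_ (orderedPairs≡sumF² (λ x y → x <ᶠ y ∧ P x y)) (orderedPairs≡sumF² (λ x y → x <ᶠ y ∧ P x y))) ⟩
  pairCount P + pairCount P ∎
  where
  open ≡-Reasoning
  _<ᶠ_ : ∀ {v} → Fin v → Fin v → Bool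
  x <ᶠ y = toℕ x <ᵇ toℕ y
  distinct : ∀ {v} (x y : Fin v) → 𝟙 (x ≢ᵇ y) ≡ 𝟙 (x <ᶠ y) + 𝟙 (y <ᶠ x)
  distinct fzero fzero = refl
  distinct fzero (fsuc y) = refl
  distinct (fsuc x) fzero = refl
  distinct (fsuc x) (fsuc y) = distinct x y
  split : ∀ x y → 𝟙 (P x y ∧ x ≢ᵇ y) ≡ 𝟙 (x <ᶠ y ∧ P x y) + 𝟙 (y <ᶠ x ∧ P y x)
  split x y rewrite sym (P-sym x y) with P x y
  ... | true = trans (distinct x y) (sym (cong₂ _+_ (cong 𝟙 (∧-identityʳ (x <ᶠ y))) (cong 𝟙 (∧-identityʳ (y <ᶠ x)))))
  ... | false = sym (cong₂ _+_ (cong 𝟙 (∧-zeroʳ (x <ᶠ y))) (cong 𝟙 (∧-zeroʳ (y <ᶠ x))))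

pairCount-mono : ∀ {v} {P P′ : Fin v → Fin v → Bool} →
  (∀ x y → P x y ≡ true → P′ x y ≡ true) → pairCount P ≤ pairCount P′
pairCount-mono P⊆P′ = sumF-mono (λ x → countF-mono (λ y → ∧-mono (P⊆P′ x y)))
  where
  ∧-mono : ∀ {a p p′} → (p ≡ true → p′ ≡ true) → (a ∧ p) ≡ true → (a ∧ p′) ≡ true
  ∧-mono {true} p⇒p′ = p⇒p′

image-apply : ∀ {v} (g : Permutation′ v) (T : Subset v) x → lookup (image g T) (g ⟨$⟩ʳ x) ≡ lookup T x
image-apply g T x = trans (lookup∘tabulate _ (g ⟨$⟩ʳ x)) (cong (lookup T) (inverseˡ g))

pairsIn-image : ∀ {v} (g : Permutation′ v) (T : Subset v) (W : Fin v → Fin v → Bool) →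
  (∀ x y → W (g ⟨$⟩ʳ x) (g ⟨$⟩ʳ y) ≡ W x y) →
  pairsIn (lookup (image g T)) W ≡ pairsIn (lookup T) W
pairsIn-image g T W W-inv =
  trans (orderedPairs-permute g (λ x y → lookup (image g T) x ∧ lookup (image g T) y ∧ W x y))
        (orderedPairs-cong (λ x y → cong₂ _∧_ (image-apply g T x)
                                     (cong₂ _∧_ (image-apply g T y) (W-inv x y))))

countF-image : ∀ {v} (g : Permutation′ v) (T : Subset v) (Q : Fin v → Bool) →
  (∀ x → Q (g ⟨$⟩ʳ x) ≡ Q x) →
  countF (λ x → lookup (image g T) x ∧ Q x) ≡ countF (λ x → lookup T x ∧ Q x)
countF-image g T Q Q-inv =
  trans (countF-permute g (λ x → lookup (image g T) x ∧ Q x))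
        (countF-cong (λ x → cong₂ _∧_ (image-apply g T x) (Q-inv x)))

module DoubleCounting {v k λ' b} {B : Fin b → Subset v} (design : IsDesign v k λ' b B) where

  open IsDesign design

  block : Fin b → Fin v → Bool
  block i = lookup (B i)

  sumF-pairsIn-blocks : (W : Fin v → Fin v → Bool) → (∀ x y → W x y ≡ true → x ≢ y) →
    sumF (λ i → pairsIn (block i) W) ≡ λ' * orderedPairs W
  sumF-pairsIn-blocks W W-irrefl = begin
    sumF (λ i → pairsIn (block i) W)
      ≡⟨ sumF-cong (λ i → orderedPairs≡sumF² (λ x y → block i x ∧ block i y ∧ W x y)) ⟩
    sumF (λ i → sumF (λ x → sumF (λ y → 𝟙 (block i x ∧ block i y ∧ W x y))))
      ≡⟨ sumF-comm (λ i x → sumF (λ y → 𝟙 (block i x ∧ block i y ∧ W x y))) ⟩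
    sumF (λ x → sumF (λ i → sumF (λ y → 𝟙 (block i x ∧ block i y ∧ W x y))))
      ≡⟨ sumF-cong (λ x → sumF-comm (λ i y → 𝟙 (block i x ∧ block i y ∧ W x y))) ⟩
    sumF (λ x → sumF (λ y → sumF (λ i → 𝟙 (block i x ∧ block i y ∧ W x y))))
      ≡⟨ sumF-cong (λ x → sumF-cong (λ y →
           trans (sym (countF≡sumF (λ i → block i x ∧ block i y ∧ W x y))) (blocksThrough x y))) ⟩
    sumF (λ x → sumF (λ y → λ' * 𝟙 (W x y)))
      ≡⟨ sumF-cong (λ x → trans (sumF-*ˡ λ' (λ y → 𝟙 (W x y))) (cong (λ' *_) (sym (countF≡sumF (W x))))) ⟩
    sumF (λ x → λ' * countF (W x))
      ≡⟨ sumF-*ˡ λ' (λ x → countF (W x)) ⟩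
    λ' * orderedPairs W ∎
    where
    open ≡-Reasoning
    blocksThrough : ∀ x y → countF (λ i → block i x ∧ block i y ∧ W x y) ≡ λ' * 𝟙 (W x y)
    blocksThrough x y with W x y in Wxy
    ... | true  = trans (countF-cong (λ i → cong (block i x ∧_) (∧-identityʳ (block i y))))
                        (trans (balanced x y (W-irrefl x y Wxy)) (sym (*-identityʳ λ')))
    ... | false = trans (countF-cong (λ i → cong (block i x ∧_) (∧-zeroʳ (block i y))))
                        (trans (countF-cong (λ i → ∧-zeroʳ (block i x)))
                               (trans (countF-false b) (sym (*-zeroʳ λ'))))

  blocks-full : k ≡ v → ∀ i x → block i x ≡ true
  blocks-full k≡v i x = countF≤⇒⊇ᵇ {f = block i} (λ _ _ → refl)
    (≤-reflexive (trans (countF-true v) (sym (trans (blocks-size i) k≡v)))) x refl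

  pairsIn-full : k ≡ v → ∀ i W → pairsIn (block i) W ≡ orderedPairs W
  pairsIn-full k≡v i W = orderedPairs-cong λ x y →
    cong₂ (λ a c → a ∧ c ∧ W x y) (blocks-full k≡v i x) (blocks-full k≡v i y)

  design-equation : (W : Fin v → Fin v → Bool) → (∀ x y → W x y ≡ true → x ≢ y) →
    ∀ {N} → (∀ i → pairsIn (block i) W ≡ N) → b * N ≡ λ' * orderedPairs W
  design-equation W W-irrefl {N} constant =
    trans (sym (trans (sumF-cong constant) (sumF-const b N))) (sumF-pairsIn-blocks W W-irrefl)

-- Block's lemma

increasing-stabilises : ∀ {v} (R : ℕ → Fin v → Bool) → (∀ n → R n ⊆ᵇ R (suc n)) →
  ∃ λ n → R (suc n) ⊆ᵇ R n
increasing-stabilises {v} R increasing =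
  [ (λ stable → stable) , (λ tooBig → ⊥-elim (1+n≰n (≤-trans tooBig (countF≤ (R (suc v)))))) ]′ (grows (suc v))
  where
  grows : ∀ n → (∃ λ m → R (suc m) ⊆ᵇ R m) ⊎ (n ≤ countF (R n))
  grows zero = inj₂ z≤n
  grows (suc n) with grows n
  ... | inj₁ stable = inj₁ stable
  ... | inj₂ n≤∣Rn∣ with countF (R (suc n)) ≤? countF (R n)
  ...   | yes noGrowth = inj₁ (n , countF≤⇒⊇ᵇ (increasing n) noGrowth)
  ...   | no growth    = inj₂ (≤-trans (s≤s n≤∣Rn∣) (≰⇒> growth))

-- G is only a predicate, so its orbits are not decidable; the orbit of the subgroup
-- generated by finitely many known elements is, since it saturates after at most v steps.
module Orbit {v m} (gen : Fin m → Permutation′ v) (x₀ : Fin v) where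

  reach : ℕ → Fin v → Bool
  reach zero    y = ⌊ x₀ ≟ y ⌋
  reach (suc n) y = reach n y ∨ ⌊ any? (λ j → reach n (gen j ⟨$⟩ˡ y) ≟ᴮ true
                                          ⊎-dec reach n (gen j ⟨$⟩ʳ y) ≟ᴮ true) ⌋

  reach-incr : ∀ n → reach n ⊆ᵇ reach (suc n)
  reach-incr n y reached rewrite reached = refl

  private
    stabilises : ∃ λ n → reach (suc n) ⊆ᵇ reach n
    stabilises = increasing-stabilises reach reach-incr

  orbit : Fin v → Bool
  orbit = reach (proj₁ stabilises)

  orbit-x₀ : orbit x₀ ≡ true
  orbit-x₀ = reach-x₀ (proj₁ stabilises)
    where
    reach-x₀ : ∀ n → reach n x₀ ≡ true
    reach-x₀ zero = ⌊⌋-complete (x₀ ≟ x₀) refl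
    reach-x₀ (suc n) = reach-incr n x₀ (reach-x₀ n)

  orbit-gen : ∀ j y → orbit (gen j ⟨$⟩ʳ y) ≡ orbit y
  orbit-gen j y = bool-ext backward forward
    where
    N = proj₁ stabilises
    step : ∀ z → (reach N (gen j ⟨$⟩ˡ z) ≡ true ⊎ reach N (gen j ⟨$⟩ʳ z) ≡ true) → orbit z ≡ true
    step z s = proj₂ stabilises z (trans (cong (reach N z ∨_) (⌊⌋-complete (any? _) (j , s))) (∨-zeroʳ (reach N z)))
    forward : orbit y ≡ true → orbit (gen j ⟨$⟩ʳ y) ≡ true
    forward oy = step (gen j ⟨$⟩ʳ y) (inj₁ (trans (cong (reach N) (inverseˡ (gen j))) oy))
    backward : orbit (gen j ⟨$⟩ʳ y) ≡ true → orbit y ≡ true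
    backward ogy = step y (inj₂ ogy)

  orbit-reached : (G : Permutation′ v → Set) → G id → (∀ g h → G g → G h → G (g ∘ₚ h)) →
    (∀ g → G g → G (flip g)) → (∀ j → G (gen j)) →
    ∀ y → orbit y ≡ true → ∃ λ h → G h × h ⟨$⟩ʳ x₀ ≡ y
  orbit-reached G G-id G-∘ G-flip G-gen = reached (proj₁ stabilises)
    where
    reached : ∀ n y → reach n y ≡ true → ∃ λ h → G h × h ⟨$⟩ʳ x₀ ≡ y
    reached zero y x₀≡y = id , G-id , ⌊⌋-sound (x₀ ≟ y) x₀≡y
    reached (suc n) y r with reach n y in earlier
    ... | true = reached n y earlier
    ... | false with ⌊⌋-sound (any? _) r
    ...   | j , inj₁ back with reached n (gen j ⟨$⟩ˡ y) back
    ...     | h , Gh , hx₀ = h ∘ₚ gen j , G-∘ h (gen j) Gh (G-gen j) ,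
                             trans (cong (gen j ⟨$⟩ʳ_) hx₀) (inverseʳ (gen j))
    reached (suc n) y r | false | j , inj₂ fwd with reached n (gen j ⟨$⟩ʳ y) fwd
    ...     | h , Gh , hx₀ = h ∘ₚ flip (gen j) , G-∘ h (flip (gen j)) Gh (G-flip (gen j) (G-gen j)) ,
                             trans (cong (gen j ⟨$⟩ˡ_) hx₀) (inverseˡ (gen j))

block-arithmetic : ∀ b λ' a a′ o o′ k v .{{_ : NonZero λ'}} .{{_ : NonZero o}} .{{_ : NonZero o′}} →
  a + a′ ≡ k → o + o′ ≡ v →
  b * (a * (k ∸ 1)) ≡ λ' * (o * (v ∸ 1)) →
  b * (a′ * (k ∸ 1)) ≡ λ' * (o′ * (v ∸ 1)) →
  b * (a * a′) ≡ λ' * (o * o′) → k ≡ v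
-- With K = k ∸ 1 and V = v ∸ 1: the equations give bK² = λV² and bkK = λvV, hence Vk = vK.
block-arithmetic b λ' a a′ o o′ k v sizeA sizeO fromA fromA′ across = begin
  k               ≡⟨ sym (m+[n∸m]≡n 1≤k) ⟩
  suc K           ≡⟨ cong suc (+-cancelʳ-≡ (V * K) K V (sym (trans (sym (*-suc V K)) cross′))) ⟩
  suc V           ≡⟨ m+[n∸m]≡n 1≤v ⟩
  v               ∎
  where
  open ≡-Reasoning
  K = k ∸ 1
  V = v ∸ 1
  1≤v : 1 ≤ v
  1≤v = subst (1 ≤_) sizeO (≤-trans (>-nonZero⁻¹ o) (m≤m+n o o′))
  instance
    V≢0 : NonZero V
    V≢0 = >-nonZero (∸-monoˡ-≤ 1 (subst (2 ≤_) sizeO (+-mono-≤ (>-nonZero⁻¹ o) (>-nonZero⁻¹ o′))))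
    oo′≢0 : NonZero (o * o′)
    oo′≢0 = m*n≢0 o o′
    λ'oo′≢0 : NonZero (λ' * (o * o′))
    λ'oo′≢0 = m*n≢0 λ' (o * o′)
    oV≢0 : NonZero (o * V)
    oV≢0 = m*n≢0 o V
    λ'V≢0 : NonZero (λ' * V)
    λ'V≢0 = m*n≢0 λ' V
  1≤k : 1 ≤ k
  1≤k = n≢0⇒n>0 λ k≡0 → ≢-nonZero⁻¹ (λ' * (o * V)) {{m*n≢0 λ' (o * V)}}
    (trans (sym (subst (λ n → b * (a * (n ∸ 1)) ≡ λ' * (o * V)) k≡0 fromA))
           (trans (cong (b *_) (*-zeroʳ a)) (*-zeroʳ b)))
  squares : b * (K * K) ≡ λ' * (V * V)
  squares = *-cancelˡ-≡ _ _ (λ' * (o * o′)) (begin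
    (λ' * (o * o′)) * (b * (K * K))   ≡⟨ cong (_* (b * (K * K))) (sym across) ⟩
    (b * (a * a′)) * (b * (K * K))    ≡⟨ interchange b a a′ K ⟩
    (b * (a * K)) * (b * (a′ * K))    ≡⟨ cong₂ _*_ fromA fromA′ ⟩
    (λ' * (o * V)) * (λ' * (o′ * V))  ≡⟨ sym (interchange λ' o o′ V) ⟩
    (λ' * (o * o′)) * (λ' * (V * V))  ∎)
    where
    interchange : ∀ x y z w → (x * (y * z)) * (x * (w * w)) ≡ (x * (y * w)) * (x * (z * w))
    interchange = solve-∀
  total : b * (k * K) ≡ λ' * (v * V)
  total = begin
    b * (k * K)                   ≡⟨ cong (λ n → b * (n * K)) (sym sizeA) ⟩
    b * ((a + a′) * K)            ≡⟨ distrib b a a′ K ⟩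
    b * (a * K) + b * (a′ * K)    ≡⟨ cong₂ _+_ fromA fromA′ ⟩
    λ' * (o * V) + λ' * (o′ * V)  ≡⟨ sym (distrib λ' o o′ V) ⟩
    λ' * ((o + o′) * V)           ≡⟨ cong (λ n → λ' * (n * V)) sizeO ⟩
    λ' * (v * V)                  ∎
    where
    distrib : ∀ x y z w → x * ((y + z) * w) ≡ x * (y * w) + x * (z * w)
    distrib = solve-∀
  cross : V * k ≡ v * K
  cross = *-cancelˡ-≡ _ _ (λ' * V) (begin
    (λ' * V) * (V * k)        ≡⟨ rearrange₁ λ' V k ⟩
    (λ' * (V * V)) * k        ≡⟨ cong (_* k) (sym squares) ⟩
    (b * (K * K)) * k         ≡⟨ rearrange₂ b K k ⟩
    (b * (k * K)) * K         ≡⟨ cong (_* K) total ⟩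
    (λ' * (v * V)) * K        ≡⟨ rearrange₃ λ' v V K ⟩
    (λ' * V) * (v * K)        ∎)
    where
    rearrange₁ : ∀ x y z → (x * y) * (y * z) ≡ (x * (y * y)) * z
    rearrange₁ = solve-∀
    rearrange₂ : ∀ x y z → (x * (y * y)) * z ≡ (x * (z * y)) * y
    rearrange₂ = solve-∀
    rearrange₃ : ∀ x y z w → (x * (y * z)) * w ≡ (x * z) * (y * w)
    rearrange₃ = solve-∀
  cross′ : V * suc K ≡ suc V * K
  cross′ = subst₂ (λ k′ v′ → V * k′ ≡ v′ * K) (sym (m+[n∸m]≡n 1≤k)) (sym (m+[n∸m]≡n 1≤v)) cross

PointTransitive : ∀ {v} → (Permutation′ v → Set) → Set
PointTransitive G = ∀ x y → ∃ λ g → G g × g ⟨$⟩ʳ x ≡ y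

module BlockLemma {v k λ' b} {B : Fin b → Subset v} (design : IsDesign v k λ' b B)
  {G : Permutation′ v → Set} (aut : IsAutSubgroup B G) (bt : BlockTransitive B G) where

  open IsDesign design
  open IsAutSubgroup aut
  open DoubleCounting design

  module _ (i₀ : Fin b) (x₀ : Fin v) where

    carry : Fin b → Permutation′ v
    carry i = proj₁ (bt i₀ i)

    open Orbit carry x₀ public

    CarryInvariant : (Fin v → Bool) → Set
    CarryInvariant Q = ∀ i x → Q (carry i ⟨$⟩ʳ x) ≡ Q x

    inBlock : (Fin v → Bool) → Fin b → ℕ
    inBlock Q i = countF (λ x → block i x ∧ Q x)

    inBlock-constant : ∀ Q → CarryInvariant Q → ∀ i → inBlock Q i ≡ inBlock Q i₀
    inBlock-constant Q Q-inv i =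
      subst (λ T → countF (λ x → lookup T x ∧ Q x) ≡ inBlock Q i₀) (proj₂ (proj₂ (bt i₀ i)))
            (countF-image (carry i) (B i₀) Q (Q-inv i))

    fromSet-equation : ∀ Q → CarryInvariant Q →
      b * (inBlock Q i₀ * (k ∸ 1)) ≡ λ' * (countF Q * (v ∸ 1))
    fromSet-equation Q Q-inv = trans
      (design-equation (λ x y → Q x ∧ x ≢ᵇ y) (λ x y w → ≢ᵇ⇒≢ (∧-conicalʳ (Q x) _ w))
        (λ i → trans (pairsIn-fromSet (block i) Q)
                     (cong₂ (λ a n → a * (n ∸ 1)) (inBlock-constant Q Q-inv i) (blocks-size i))))
      (cong (λ' *_) (trans (pairsIn-fromSet (λ _ → true) Q) (cong (λ n → countF Q * (n ∸ 1)) (countF-true v))))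

    across-equation : ∀ Q → CarryInvariant Q →
      b * (inBlock Q i₀ * inBlock (not ∘ Q) i₀) ≡ λ' * (countF Q * countF (not ∘ Q))
    across-equation Q Q-inv = trans
      (design-equation (λ x y → Q x ∧ not (Q y)) irrefl
        (λ i → trans (pairsIn-acrossSet (block i) Q)
                     (cong₂ _*_ (inBlock-constant Q Q-inv i)
                                (inBlock-constant (not ∘ Q) (λ j x → cong not (Q-inv j x)) i))))
      (cong (λ' *_) (pairsIn-acrossSet (λ _ → true) Q))
      where
      irrefl : ∀ x y → (Q x ∧ not (Q y)) ≡ true → x ≢ y
      irrefl x .x w refl with () ← trans (sym w) (∧-inverseʳ (Q x))

    orbit-everywhere : k ≢ v → ∀ y → orbit y ≡ true
    orbit-everywhere k≢v y with countF (not ∘ orbit) in outside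
    ... | zero  = not-injective (countF≡0 (not ∘ orbit) outside y)
    ... | suc _ = ⊥-elim (k≢v (block-arithmetic b λ' (inBlock orbit i₀) (inBlock (not ∘ orbit) i₀)
                                 (countF orbit) (countF (not ∘ orbit)) k v
                                 {{>-nonZero λ-pos}} {{>-nonZero (countF-pos orbit orbit-x₀)}}
                                 {{>-nonZero (subst (1 ≤_) (sym outside) (s≤s z≤n))}}
                                 blockSplit pointSplit
                                 (fromSet-equation orbit orbit-gen) (fromSet-equation (not ∘ orbit) outside-gen)
                                 (across-equation orbit orbit-gen)))
      where
      blockSplit : inBlock orbit i₀ + inBlock (not ∘ orbit) i₀ ≡ k
      blockSplit = trans (sym (countF-split (block i₀) orbit)) (blocks-size i₀)
      pointSplit : countF orbit + countF (not ∘ orbit) ≡ v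
      pointSplit = trans (sym (countF-split (λ _ → true) orbit)) (countF-true v)
      outside-gen : CarryInvariant (not ∘ orbit)
      outside-gen j x = cong not (orbit-gen j x)

  blockTransitive⇒pointTransitive : Fin b → k ≢ v → PointTransitive G
  blockTransitive⇒pointTransitive i₀ k≢v x y =
    orbit-reached i₀ x G has-id has-∘ has-inv (λ i → proj₁ (proj₂ (bt i₀ i))) y (orbit-everywhere i₀ x k≢v y)

-- Invariant partitions

PreservedBy : ∀ {v} {A : Set} → (Permutation′ v → Set) → (Fin v → A) → Set
PreservedBy G L = ∀ g → G g → ∀ x y → L x ≡ L y → L (g ⟨$⟩ʳ x) ≡ L (g ⟨$⟩ʳ y)

module Labelling {A : Set} (_≟ᴬ_ : DecidableEquality A) {v : ℕ} (L : Fin v → A) where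

  _~_ : Fin v → Fin v → Bool
  x ~ y = ⌊ L x ≟ᴬ L y ⌋

  ~-sound : ∀ {x y} → x ~ y ≡ true → L x ≡ L y
  ~-sound {x} {y} = ⌊⌋-sound (L x ≟ᴬ L y)

  ~-complete : ∀ {x y} → L x ≡ L y → x ~ y ≡ true
  ~-complete {x} {y} = ⌊⌋-complete (L x ≟ᴬ L y)

  ~-sym : ∀ x y → x ~ y ≡ y ~ x
  ~-sym x y = bool-ext (λ e → ~-complete (sym (~-sound e))) (λ e → ~-complete (sym (~-sound e)))

  classSize : Fin v → ℕ
  classSize x = countF (_~ x)

  innerIn : Subset v → ℕ
  innerIn S = pairCount (λ x y → lookup S x ∧ lookup S y ∧ x ~ y)

  outerIn : Subset v → ℕ
  outerIn S = pairCount (λ x y → lookup S x ∧ lookup S y ∧ not (x ~ y))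

  private
    inBoth-sym : ∀ (S : Subset v) (R : Fin v → Fin v → Bool) → (∀ x y → R x y ≡ R y x) →
      ∀ x y → (lookup S x ∧ lookup S y ∧ R x y) ≡ (lookup S y ∧ lookup S x ∧ R y x)
    inBoth-sym S R R-sym x y rewrite R-sym x y with lookup S x | lookup S y
    ... | true  | _ = refl
    ... | false | b = sym (∧-zeroʳ b)

  pairsIn-inner : ∀ S → pairsIn (lookup S) (λ x y → x ~ y ∧ x ≢ᵇ y) ≡ innerIn S + innerIn S
  pairsIn-inner S = trans (orderedPairs-cong reassociate)
    (orderedPairs-halves (λ x y → lookup S x ∧ lookup S y ∧ x ~ y) (inBoth-sym S _~_ ~-sym))
    where
    reassociate : ∀ x y → (lookup S x ∧ lookup S y ∧ x ~ y ∧ x ≢ᵇ y) ≡ ((lookup S x ∧ lookup S y ∧ x ~ y) ∧ x ≢ᵇ y)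
    reassociate x y = sym (trans (∧-assoc (lookup S x) _ _) (cong (lookup S x ∧_) (∧-assoc (lookup S y) _ _)))

  pairsIn-outer : ∀ S → pairsIn (lookup S) (λ x y → not (x ~ y)) ≡ outerIn S + outerIn S
  pairsIn-outer S = trans (orderedPairs-cong distinct)
    (orderedPairs-halves (λ x y → lookup S x ∧ lookup S y ∧ not (x ~ y))
                         (inBoth-sym S (λ x y → not (x ~ y)) (λ x y → cong not (~-sym x y))))
    where
    distinct : ∀ x y → (lookup S x ∧ lookup S y ∧ not (x ~ y)) ≡ ((lookup S x ∧ lookup S y ∧ not (x ~ y)) ∧ x ≢ᵇ y)
    distinct x y with x ≟ y
    ... | yes refl rewrite ~-complete {x} {x} refl =
      trans (cong (lookup S x ∧_) (∧-zeroʳ (lookup S x))) (trans (∧-zeroʳ (lookup S x)) (sym (∧-zeroʳ _)))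
    ... | no _ = sym (∧-identityʳ _)

  ~-invariant : ∀ {G : Permutation′ v → Set} → (∀ g → G g → G (flip g)) → PreservedBy G L →
    ∀ g → G g → ∀ x y → (g ⟨$⟩ʳ x) ~ (g ⟨$⟩ʳ y) ≡ x ~ y
  ~-invariant G-flip L-inv g Gg x y = bool-ext backward forward
    where
    forward : x ~ y ≡ true → (g ⟨$⟩ʳ x) ~ (g ⟨$⟩ʳ y) ≡ true
    forward x~y = ~-complete (L-inv g Gg x y (~-sound x~y))
    backward : (g ⟨$⟩ʳ x) ~ (g ⟨$⟩ʳ y) ≡ true → x ~ y ≡ true
    backward gx~gy = ~-complete (subst₂ (λ a c → L a ≡ L c) (inverseˡ g) (inverseˡ g)
                                  (L-inv (flip g) (G-flip g Gg) _ _ (~-sound gx~gy)))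

  classSize-constant : ∀ {G : Permutation′ v → Set} → (∀ g → G g → G (flip g)) → PreservedBy G L →
    PointTransitive G → ∀ x y → classSize x ≡ classSize y
  classSize-constant G-flip L-inv transitive x y with transitive x y
  ... | g , Gg , refl = sym (trans (countF-permute g (_~ (g ⟨$⟩ʳ x)))
                                   (countF-cong (λ z → ~-invariant G-flip L-inv g Gg z x)))

  module ConstantClassSize (s : ℕ) (size : ∀ x → classSize x ≡ s) where

    classOf : ∀ x → countF (x ~_) ≡ s
    classOf x = trans (countF-cong (~-sym x)) (size x)

    inner-orderedPairs : orderedPairs (λ x y → x ~ y ∧ x ≢ᵇ y) ≡ v * (s ∸ 1)
    inner-orderedPairs = orderedPairs-constRows _ λ x →
      trans (countF-remove (x ~_) (~-complete refl)) (cong (_∸ 1) (classOf x))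

    outer-orderedPairs : orderedPairs (λ x y → not (x ~ y)) ≡ v * (v ∸ s)
    outer-orderedPairs = orderedPairs-constRows _ λ x → begin
      countF (λ y → not (x ~ y))                ≡⟨ sym (m+n∸m≡n s _) ⟩
      s + countF (λ y → not (x ~ y)) ∸ s        ≡⟨ cong (λ n → n + countF (λ y → not (x ~ y)) ∸ s) (sym (classOf x)) ⟩
      countF (x ~_) + countF (λ y → not (x ~ y)) ∸ s ≡⟨ cong (_∸ s) (sym (countF-split (λ _ → true) (x ~_))) ⟩
      countF {v} (λ _ → true) ∸ s               ≡⟨ cong (_∸ s) (countF-true v) ⟩
      v ∸ s                                     ∎
      where open ≡-Reasoning

    Closed : (Fin v → Bool) → Set
    Closed Q = ∀ x y → Q x ≡ true → x ~ y ≡ true → Q y ≡ true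

    classSize∣closed : ∀ n (Q : Fin v → Bool) → countF Q ≤ n → Closed Q → s ∣ countF Q
    classSize∣closed n Q Q≤n closed with countF Q in ∣Q∣
    ... | zero = s ∣0
    classSize∣closed zero Q () closed | suc _
    classSize∣closed (suc n) Q Q≤n closed | suc _ with countF-witness Q (subst (1 ≤_) (sym ∣Q∣) (s≤s z≤n))
    ... | x , Qx = subst (s ∣_) (trans split ∣Q∣) (∣m∣n⇒∣m+n ∣-refl (classSize∣closed n Q′ Q′≤n Q′-closed))
      where
      Q′ : Fin v → Bool
      Q′ y = Q y ∧ not (x ~ y)
      classOfx : countF (λ y → Q y ∧ x ~ y) ≡ s
      classOfx = trans (countF-cong inQ) (classOf x)
        where
        inQ : ∀ y → (Q y ∧ x ~ y) ≡ x ~ y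
        inQ y with x ~ y in x~y
        ... | true  = trans (∧-identityʳ (Q y)) (closed x y Qx x~y)
        ... | false = ∧-zeroʳ (Q y)
      split : s + countF Q′ ≡ countF Q
      split = trans (cong (_+ countF Q′) (sym classOfx)) (sym (countF-split Q (x ~_)))
      Q′≤n : countF Q′ ≤ n
      Q′≤n = ≤-pred (≤-trans (+-monoˡ-≤ (countF Q′) (subst (1 ≤_) (size x) (countF-pos (_~ x) (~-complete refl))))
                              (≤-trans (≤-reflexive (trans split ∣Q∣)) Q≤n))
      Q′-closed : Closed Q′
      Q′-closed y z Q′y y~z with Q y in Qy | x ~ y in x~y
      ... | true | false rewrite closed y z Qy y~z with x ~ z in x~z
      ...   | false = refl
      ...   | true with () ← trans (sym x~y) (~-complete (trans (~-sound x~z) (sym (~-sound y~z))))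

    classSize∣v : s ∣ v
    classSize∣v = subst (s ∣_) (countF-true v) (classSize∣closed v (λ _ → true) (countF≤ _) (λ _ _ _ _ → refl))

module InvariantPartition {v k λ' b} {B : Fin b → Subset v} (design : IsDesign v k λ' b B)
  {G : Permutation′ v → Set} (aut : IsAutSubgroup B G) (bt : BlockTransitive B G)
  {A : Set} (_≟ᴬ_ : DecidableEquality A) (L : Fin v → A) (L-inv : PreservedBy G L)
  (s : ℕ) (size : ∀ x → Labelling.classSize _≟ᴬ_ L x ≡ s) where

  open IsAutSubgroup aut
  open DoubleCounting design
  open Labelling _≟ᴬ_ L
  open ConstantClassSize s size

  pairsIn-constant : (W : Fin v → Fin v → Bool) →
    (∀ g → G g → ∀ x y → W (g ⟨$⟩ʳ x) (g ⟨$⟩ʳ y) ≡ W x y) →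
    ∀ i j → pairsIn (block i) W ≡ pairsIn (block j) W
  pairsIn-constant W W-inv i j with bt i j
  ... | g , Gg , gBi≡Bj =
    trans (sym (pairsIn-image g (B i) W (W-inv g Gg))) (cong (λ T → pairsIn (lookup T) W) gBi≡Bj)

  inner-equation : ∀ i → b * (innerIn (B i) + innerIn (B i)) ≡ λ' * (v * (s ∸ 1))
  inner-equation i = begin
    b * (innerIn (B i) + innerIn (B i))  ≡⟨ cong (b *_) (sym (pairsIn-inner (B i))) ⟩
    b * pairsIn (block i) W              ≡⟨ design-equation W irrefl (λ j → pairsIn-constant W W-inv j i) ⟩
    λ' * orderedPairs W                  ≡⟨ cong (λ' *_) inner-orderedPairs ⟩
    λ' * (v * (s ∸ 1))                   ∎
    where
    open ≡-Reasoning
    W : Fin v → Fin v → Bool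
    W x y = x ~ y ∧ x ≢ᵇ y
    irrefl : ∀ x y → W x y ≡ true → x ≢ y
    irrefl x y w = ≢ᵇ⇒≢ (∧-conicalʳ (x ~ y) _ w)
    W-inv : ∀ g → G g → ∀ x y → W (g ⟨$⟩ʳ x) (g ⟨$⟩ʳ y) ≡ W x y
    W-inv g Gg x y = cong₂ _∧_ (~-invariant has-inv L-inv g Gg x y) (≢ᵇ-permute g x y)

  outer-equation : ∀ i → b * (outerIn (B i) + outerIn (B i)) ≡ λ' * (v * (v ∸ s))
  outer-equation i = begin
    b * (outerIn (B i) + outerIn (B i))  ≡⟨ cong (b *_) (sym (pairsIn-outer (B i))) ⟩
    b * pairsIn (block i) W              ≡⟨ design-equation W irrefl (λ j → pairsIn-constant W W-inv j i) ⟩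
    λ' * orderedPairs W                  ≡⟨ cong (λ' *_) outer-orderedPairs ⟩
    λ' * (v * (v ∸ s))                   ∎
    where
    open ≡-Reasoning
    W : Fin v → Fin v → Bool
    W x y = not (x ~ y)
    irrefl : ∀ x y → W x y ≡ true → x ≢ y
    irrefl x .x w refl with () ← trans (sym w) (cong not (~-complete {x} refl))
    W-inv : ∀ g → G g → ∀ x y → W (g ⟨$⟩ʳ x) (g ⟨$⟩ʳ y) ≡ W x y
    W-inv g Gg x y = cong not (~-invariant has-inv L-inv g Gg x y)

double-count-ratio : ∀ b λ' v Y Z o i .{{_ : NonZero b}} .{{_ : NonZero λ'}} .{{_ : NonZero v}} →
  b * (o + o) ≡ λ' * (v * Y) → b * (i + i) ≡ λ' * (v * Z) → o * Z ≡ i * Y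
double-count-ratio b λ' v Y Z o i fromO fromI = *-cancelˡ-≡ (o * Z) (i * Y) (2 * (b * (λ' * v))) (begin
  2 * (b * (λ' * v)) * (o * Z)   ≡⟨ rearrange b λ' v o Z ⟩
  b * (o + o) * (λ' * (v * Z))   ≡⟨ cong₂ _*_ fromO (sym fromI) ⟩
  λ' * (v * Y) * (b * (i + i))   ≡⟨ sym (trans (rearrange b λ' v i Y) (*-comm (b * (i + i)) (λ' * (v * Y)))) ⟩
  2 * (b * (λ' * v)) * (i * Y)   ∎)
  where
  open ≡-Reasoning
  rearrange : ∀ b λ' v o Z → 2 * (b * (λ' * v)) * (o * Z) ≡ b * (o + o) * (λ' * (v * Z))
  rearrange = solve-∀
  instance
    λ'v≢0 : NonZero (λ' * v)
    λ'v≢0 = m*n≢0 λ' v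
    bλ'v≢0 : NonZero (b * (λ' * v))
    bλ'v≢0 = m*n≢0 b (λ' * v)
    2bλ'v≢0 : NonZero (2 * (b * (λ' * v)))
    2bλ'v≢0 = m*n≢0 2 (b * (λ' * v))

∣-from-ratio : ∀ s v o i → s ∣ v → 1 ≤ s → s ≤ v → o * (s ∸ 1) ≡ i * (v ∸ s) → s ∣ o
∣-from-ratio s v o i s∣v 1≤s s≤v ratio = ∣m+n∣m⇒∣n (subst (s ∣_) o*s≡ (∣n⇒∣m*n o ∣-refl)) s∣i*[v∸s]
  where
  open ≡-Reasoning
  s∣i*[v∸s] : s ∣ i * (v ∸ s)
  s∣i*[v∸s] = ∣n⇒∣m*n i (∣m+n∣m⇒∣n (subst (s ∣_) (sym (m+[n∸m]≡n s≤v)) s∣v) ∣-refl)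
  o*s≡ : o * s ≡ i * (v ∸ s) + o
  o*s≡ = begin
    o * s                 ≡⟨ cong (o *_) (sym (m+[n∸m]≡n 1≤s)) ⟩
    o * suc (s ∸ 1)       ≡⟨ *-suc o (s ∸ 1) ⟩
    o + o * (s ∸ 1)       ≡⟨ cong (o +_) ratio ⟩
    o + i * (v ∸ s)       ≡⟨ +-comm o (i * (v ∸ s)) ⟩
    i * (v ∸ s) + o       ∎

single-pair-size : ∀ i s c → i ≤ 1 → 2 ≤ s → 1 ≤ c → i * (c ∸ 1) ≡ 1 * (s ∸ 1) → s ≡ c
single-pair-size zero (suc (suc s)) c _ (s≤s (s≤s _)) _ ()
single-pair-size (suc zero) (suc (suc s)) (suc c) _ (s≤s (s≤s _)) _ eq =
  cong suc (sym (trans (sym (+-identityʳ c)) (trans eq (+-identityʳ (suc s)))))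
single-pair-size (suc (suc _)) _ _ (s≤s ())

full-block-outer-too-large : ∀ c d → 2 ≤ c → 2 ≤ d → c + c < c * d * (c * d ∸ c)
full-block-outer-too-large c d 2≤c 2≤d = begin-strict
  c + c                   <⟨ m<m+n (c + c) (≤-trans (s≤s z≤n) (≤-trans 2≤c (m≤m+n c c))) ⟩
  (c + c) + (c + c)       ≡⟨ double c ⟩
  c * 2 * 2               ≤⟨ *-mono-≤ (*-monoʳ-≤ c 2≤d) (≤-trans 2≤c (m≤m*n c (d ∸ 1) {{d∸1≢0}})) ⟩
  c * d * (c * (d ∸ 1))   ≡⟨ cong (c * d *_) (trans (*-distribˡ-∸ c d 1) (cong (c * d ∸_) (*-identityʳ c))) ⟩
  c * d * (c * d ∸ c)     ∎
  where
  open ≤-Reasoning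
  double : ∀ c → (c + c) + (c + c) ≡ c * 2 * 2
  double = solve-∀
  d∸1≢0 : NonZero (d ∸ 1)
  d∸1≢0 = >-nonZero (∸-monoˡ-≤ 1 2≤d)

full-block-inner-too-large : ∀ c d → 2 ≤ c → 2 ≤ d → 1 + 1 < c * d * (c ∸ 1)
full-block-inner-too-large c d 2≤c 2≤d = begin-strict
  1 + 1             <⟨ s≤s (s≤s (s≤s z≤n)) ⟩
  2 * 2             ≤⟨ *-mono-≤ 2≤c 2≤d ⟩
  c * d             ≤⟨ m≤m*n (c * d) (c ∸ 1) {{>-nonZero (∸-monoˡ-≤ 1 2≤c)}} ⟩
  c * d * (c ∸ 1)   ∎
  where open ≤-Reasoning

two-points : ∀ {n} → 2 ≤ n → Σ (Fin n) λ x → Σ (Fin n) λ y → x ≢ y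
two-points {suc (suc _)} (s≤s (s≤s z≤n)) = fzero , fsuc fzero , λ ()

module Corollary {c d k λ' b} (2≤c : 2 ≤ c) (2≤d : 2 ≤ d)
  {B : Fin b → Subset (c * d)} (design : IsDesign (c * d) k λ' b B)
  {G : Permutation′ (c * d) → Set} (aut : IsAutSubgroup B G) (bt : BlockTransitive B G)
  {cls : Fin (c * d) → Fin d} (classSizes : ClassSizes cls c) (cls-inv : Invariant G cls) where

  open IsDesign design
  open IsAutSubgroup aut using (has-∘; has-inv)
  open DoubleCounting design
  open BlockLemma design aut bt using (blockTransitive⇒pointTransitive)

  v : ℕ
  v = c * d

  2≤v : 2 ≤ v
  2≤v = *-mono-≤ 2≤c (≤-trans (s≤s z≤n) 2≤d)

  i₀ : Fin b
  i₀ with two-points 2≤v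
  ... | x , y , x≢y = proj₁ (countF-witness (λ i → block i x ∧ block i y)
                                           (subst (1 ≤_) (sym (balanced x y x≢y)) λ-pos))

  instance
    b≢0 : NonZero b
    b≢0 = >-nonZero (≤-trans (s≤s z≤n) (toℕ<n i₀))
    λ'≢0 : NonZero λ'
    λ'≢0 = >-nonZero λ-pos
    v≢0 : NonZero v
    v≢0 = >-nonZero (≤-trans (s≤s z≤n) 2≤v)

  module Classes = Labelling _≟_ cls
  module ClassDesign = InvariantPartition design aut bt _≟_ cls cls-inv c (λ x → classSizes (cls x))

  representative : ∀ D → ∃ λ x → cls x ≡ D
  representative D with countF-witness (λ x → ⌊ cls x ≟ D ⌋) (subst (1 ≤_) (sym (classSizes D)) (≤-trans (s≤s z≤n) 2≤c))
  ... | x , x∈D = x , ⌊⌋-sound (cls x ≟ D) x∈D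

  x₀ : Fin v
  x₀ = proj₁ (two-points 2≤v)

  module ClassCounts = Classes.ConstantClassSize c (λ x → classSizes (cls x))

  k≢v-outer : (∀ i → outerPairs cls (B i) ≡ c) → k ≢ v
  k≢v-outer m≡1 k≡v = <⇒≢ (full-block-outer-too-large c d 2≤c 2≤d) (begin
    c + c                                          ≡⟨ sym (cong₂ _+_ (m≡1 i₀) (m≡1 i₀)) ⟩
    outerPairs cls (B i₀) + outerPairs cls (B i₀)  ≡⟨ sym (Classes.pairsIn-outer (B i₀)) ⟩
    pairsIn (block i₀) (λ x y → not (x Classes.~ y)) ≡⟨ pairsIn-full k≡v i₀ _ ⟩
    orderedPairs (λ x y → not (x Classes.~ y))     ≡⟨ ClassCounts.outer-orderedPairs ⟩
    v * (v ∸ c)                                    ∎)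
    where open ≡-Reasoning

  k≢v-inner : (∀ i → innerPairs cls (B i) ≡ 1) → k ≢ v
  k≢v-inner n≡1 k≡v = <⇒≢ (full-block-inner-too-large c d 2≤c 2≤d) (begin
    1 + 1                                          ≡⟨ sym (cong₂ _+_ (n≡1 i₀) (n≡1 i₀)) ⟩
    innerPairs cls (B i₀) + innerPairs cls (B i₀)  ≡⟨ sym (Classes.pairsIn-inner (B i₀)) ⟩
    pairsIn (block i₀) (λ x y → x Classes.~ y ∧ x ≢ᵇ y) ≡⟨ pairsIn-full k≡v i₀ _ ⟩
    orderedPairs (λ x y → x Classes.~ y ∧ x ≢ᵇ y)  ≡⟨ ClassCounts.inner-orderedPairs ⟩
    v * (c ∸ 1)                                    ∎)
    where open ≡-Reasoning

  coarser-partition-trivial : PointTransitive G → (∀ i → outerPairs cls (B i) ≡ c) →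
    (L : Fin v → ℕ) → PreservedBy G L → (∀ x y → cls x ≡ cls y → L x ≡ L y) →
    (∀ x y → L x ≡ L y → cls x ≡ cls y) ⊎ (∀ x y → L x ≡ L y)
  coarser-partition-trivial transitive m≡1 L L-inv coarser with Labelling.classSize ℕ._≟_ L x₀ ℕ.≟ v
  ... | yes s≡v = inj₂ λ x y → trans (toX₀ x) (sym (toX₀ y))
    where
    open Labelling ℕ._≟_ L
    toX₀ : ∀ z → L z ≡ L x₀
    toX₀ z = ~-sound (countF≤⇒⊇ᵇ {f = _~ x₀} (λ _ _ → refl)
                        (≤-reflexive (trans (countF-true v) (sym s≡v))) z refl)
  ... | no s≢v = inj₁ λ x y Lx≡Ly → sym (Classes.~-sound (sameClass x y (~-complete (sym Lx≡Ly))))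
    where
    open Labelling ℕ._≟_ L
    s = classSize x₀
    size : ∀ x → classSize x ≡ s
    size x = classSize-constant has-inv L-inv transitive x x₀
    open InvariantPartition design aut bt ℕ._≟_ L L-inv s size
    open ConstantClassSize s size using (classSize∣v)
    o = outerIn (B i₀)
    s<v : s < v
    s<v = ≤∧≢⇒< (countF≤ (_~ x₀)) s≢v
    instance
      v∸s≢0 : NonZero (v ∸ s)
      v∸s≢0 = >-nonZero (m<n⇒0<n∸m s<v)
      v[v∸s]≢0 : NonZero (v * (v ∸ s))
      v[v∸s]≢0 = m*n≢0 v (v ∸ s)
      o≢0 : NonZero o
      o≢0 = ≢-nonZero λ o≡0 → ≢-nonZero⁻¹ (λ' * (v * (v ∸ s))) {{m*n≢0 λ' (v * (v ∸ s))}}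
        (trans (sym (outer-equation i₀)) (trans (cong (λ n → b * (n + n)) o≡0) (*-zeroʳ b)))
    ratio : o * (s ∸ 1) ≡ innerIn (B i₀) * (v ∸ s)
    ratio = double-count-ratio b λ' v (v ∸ s) (s ∸ 1) o (innerIn (B i₀)) (outer-equation i₀) (inner-equation i₀)
    s≤o : s ≤ o
    s≤o = ∣⇒≤ (∣-from-ratio s v o (innerIn (B i₀)) classSize∣v (countF-pos (_~ x₀) (~-complete refl)) (<⇒≤ s<v) ratio)
    refines : ∀ x y → x Classes.~ y ≡ true → x ~ y ≡ true
    refines x y x~y = ~-complete (coarser x y (Classes.~-sound x~y))
    o≤c : o ≤ c
    o≤c = ≤-trans (pairCount-mono (λ x y → ∧∧-mono {block i₀ x} {block i₀ y} (not-mono (refines x y))))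
                  (≤-reflexive (m≡1 i₀))
    classSize≤c : ∀ x → classSize x ≤ c
    classSize≤c x = ≤-trans (≤-reflexive (size x)) (≤-trans s≤o o≤c)
    sameClass : ∀ x y → y ~ x ≡ true → y Classes.~ x ≡ true
    sameClass x = countF≤⇒⊇ᵇ {f = Classes._~ x} (λ y → refines y x)
                    (subst (classSize x ≤_) (sym (classSizes (cls x))) (classSize≤c x))

  K-primitive : (∀ i → outerPairs cls (B i) ≡ c) → KPrimitive G cls
  K-primitive m≡1 = classes-transitive , partitions-trivial
    where
    transitive : PointTransitive G
    transitive = blockTransitive⇒pointTransitive i₀ (k≢v-outer m≡1)
    classes-transitive : ∀ D E → ∃ λ g → G g × ∃ λ x → cls x ≡ D × cls (g ⟨$⟩ʳ x) ≡ E
    classes-transitive D E with representative D | representative E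
    ... | x , refl | y , refl with transitive x y
    ...   | g , Gg , refl = g , Gg , x , refl , refl
    partitions-trivial : ∀ (p : Fin d → ℕ) → PreservedBy G (p ∘ cls) →
      (∀ D E → p D ≡ p E → D ≡ E) ⊎ (∀ D E → p D ≡ p E)
    partitions-trivial p p-inv with coarser-partition-trivial transitive m≡1 (p ∘ cls) p-inv (λ _ _ → cong p)
    ... | inj₁ finest = inj₁ injective
      where
      injective : ∀ D E → p D ≡ p E → D ≡ E
      injective D E with representative D | representative E
      ... | x , refl | y , refl = finest x y
    ... | inj₂ coarsest = inj₂ constant
      where
      constant : ∀ D E → p D ≡ p E
      constant D E with representative D | representative E
      ... | x , refl | y , refl = coarsest x y

  finer-partition-trivial : PointTransitive G → (∀ i → innerPairs cls (B i) ≡ 1) →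
    {A : Set} (_≟ᴬ_ : DecidableEquality A) (L : Fin v → A) → PreservedBy G L →
    (∀ x y → L x ≡ L y → cls x ≡ cls y) →
    (∀ x y → L x ≡ L y → x ≡ y) ⊎ (∀ x y → cls x ≡ cls y → L x ≡ L y)
  finer-partition-trivial transitive n≡1 _≟ᴬ_ L L-inv finer with Labelling.classSize _≟ᴬ_ L x₀ ℕ.≤? 1
  ... | yes s≤1 = inj₁ λ x y Lx≡Ly →
    countF≤1⇒unique (_~ x) (≤-trans (≤-reflexive (size x)) s≤1) (~-complete refl) (~-complete (sym Lx≡Ly))
    where
    open Labelling _≟ᴬ_ L
    size : ∀ x → classSize x ≡ classSize x₀
    size x = classSize-constant has-inv L-inv transitive x x₀
  ... | no s≰1 = inj₂ λ x y cx≡cy → sym (~-sound (sameClass x y (Classes.~-complete (sym cx≡cy))))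
    where
    open Labelling _≟ᴬ_ L
    s = classSize x₀
    size : ∀ x → classSize x ≡ s
    size x = classSize-constant has-inv L-inv transitive x x₀
    open InvariantPartition design aut bt _≟ᴬ_ L L-inv s size
    atMostOnePair : innerIn (B i₀) ≤ 1
    atMostOnePair = ≤-trans (pairCount-mono (λ x y → ∧∧-mono {block i₀ x} {block i₀ y}
                                              (λ x~y → Classes.~-complete (finer x y (~-sound x~y)))))
                            (≤-reflexive (n≡1 i₀))
    classEquation : b * (1 + 1) ≡ λ' * (v * (c ∸ 1))
    classEquation = trans (cong (b *_) (sym (cong₂ _+_ (n≡1 i₀) (n≡1 i₀)))) (ClassDesign.inner-equation i₀)
    s≡c : s ≡ c
    s≡c = single-pair-size (innerIn (B i₀)) s c atMostOnePair (≰⇒> s≰1) (≤-trans (s≤s z≤n) 2≤c)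
            (double-count-ratio b λ' v (s ∸ 1) (c ∸ 1) (innerIn (B i₀)) 1 (inner-equation i₀) classEquation)
    sameClass : ∀ x y → y Classes.~ x ≡ true → y ~ x ≡ true
    sameClass x = countF≤⇒⊇ᵇ {f = _~ x} (λ y y~x → Classes.~-complete (finer y x (~-sound y~x)))
                    (≤-reflexive (trans (classSizes (cls x)) (sym (trans (size x) s≡c))))

  MapsInto : Permutation′ v → Fin d → Fin d → Set
  MapsInto g D E = ∀ z → cls z ≡ D → cls (g ⟨$⟩ʳ z) ≡ E

  maps-class : ∀ {g} → G g → ∀ {x D E} → cls x ≡ D → cls (g ⟨$⟩ʳ x) ≡ E → MapsInto g D E
  maps-class {g} Gg {x} x∈D gx∈E z z∈D = trans (cls-inv g Gg z x (trans z∈D (sym x∈D))) gx∈E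

  transporter : PointTransitive G → ∀ C D →
    Σ (Permutation′ v) λ t → G t × MapsInto t D C × MapsInto (flip t) C D
  transporter transitive C D with representative D | representative C
  ... | x , refl | y , refl with transitive x y
  ...   | t , Gt , refl = t , Gt , maps-class Gt refl refl , maps-class (has-inv t Gt) refl (cong cls (inverseˡ t))

  H-primitive : (C : Fin d) → (∀ i → innerPairs cls (B i) ≡ 1) → HPrimitive G cls C
  H-primitive C n≡1 = stabiliser-transitive , partitions-trivial
    where
    transitive : PointTransitive G
    transitive = blockTransitive⇒pointTransitive i₀ (k≢v-inner n≡1)

    stabiliser-transitive : ∀ x y → cls x ≡ C → cls y ≡ C → ∃ λ g → Stab G cls C g × g ⟨$⟩ʳ x ≡ y
    stabiliser-transitive x y x∈C y∈C with transitive x y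
    ... | g , Gg , refl = g , (Gg , maps-class Gg x∈C y∈C) , refl

    t : Fin d → Permutation′ v
    t D = proj₁ (transporter transitive C D)
    t-∈G : ∀ D → G (t D)
    t-∈G D = proj₁ (proj₂ (transporter transitive C D))
    t-maps : ∀ D → MapsInto (t D) D C
    t-maps D = proj₁ (proj₂ (proj₂ (transporter transitive C D)))
    t⁻¹-maps : ∀ D → MapsInto (flip (t D)) C D
    t⁻¹-maps D = proj₂ (proj₂ (proj₂ (transporter transitive C D)))

    partitions-trivial : ∀ (p : Fin v → ℕ) →
      (∀ g → Stab G cls C g → ∀ x y → cls x ≡ C → cls y ≡ C → p x ≡ p y → p (g ⟨$⟩ʳ x) ≡ p (g ⟨$⟩ʳ y)) →
      (∀ x y → cls x ≡ C → cls y ≡ C → p x ≡ p y → x ≡ y) ⊎ (∀ x y → cls x ≡ C → cls y ≡ C → p x ≡ p y)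
    partitions-trivial p p-inv =
      conclude (finer-partition-trivial transitive n≡1 (≡-dec _≟_ ℕ._≟_) lift lift-preserved (λ _ _ → cong proj₁))
      where
      lift : Fin v → Fin d × ℕ
      lift z = cls z , p (t (cls z) ⟨$⟩ʳ z)

      lift-preserved : PreservedBy G lift
      lift-preserved h Gh x y lx≡ly = cong₂ _,_ hx∼hy (trans samePart (cong (λ E → p (t E ⟨$⟩ʳ (h ⟨$⟩ʳ y))) hx∼hy))
        where
        x∼y : cls x ≡ cls y
        x∼y = cong proj₁ lx≡ly
        hx∼hy : cls (h ⟨$⟩ʳ x) ≡ cls (h ⟨$⟩ʳ y)
        hx∼hy = cls-inv h Gh x y x∼y
        D = cls x
        D′ = cls (h ⟨$⟩ʳ x)
        φ : Permutation′ v
        φ = flip (t D) ∘ₚ (h ∘ₚ t D′)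
        φ-stab : Stab G cls C φ
        φ-stab = has-∘ _ _ (has-inv _ (t-∈G D)) (has-∘ _ _ Gh (t-∈G D′)) ,
                 λ z z∈C → t-maps D′ _ (cls-inv h Gh _ x (t⁻¹-maps D z z∈C))
        sameInC : p (t D ⟨$⟩ʳ x) ≡ p (t D ⟨$⟩ʳ y)
        sameInC = trans (cong proj₂ lx≡ly) (cong (λ E → p (t E ⟨$⟩ʳ y)) (sym x∼y))
        samePart : p (t D′ ⟨$⟩ʳ (h ⟨$⟩ʳ x)) ≡ p (t D′ ⟨$⟩ʳ (h ⟨$⟩ʳ y))
        samePart = subst₂ (λ a a′ → p (t D′ ⟨$⟩ʳ (h ⟨$⟩ʳ a)) ≡ p (t D′ ⟨$⟩ʳ (h ⟨$⟩ʳ a′)))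
                          (inverseˡ (t D)) (inverseˡ (t D))
                          (p-inv φ φ-stab _ _ (t-maps D x refl) (t-maps D y (sym x∼y)) sameInC)

      lift-≡ : ∀ {x y} → cls x ≡ C → cls y ≡ C → p (t C ⟨$⟩ʳ x) ≡ p (t C ⟨$⟩ʳ y) → lift x ≡ lift y
      lift-≡ {x} {y} x∈C y∈C eq = cong₂ _,_ (trans x∈C (sym y∈C))
        (trans (cong (λ E → p (t E ⟨$⟩ʳ x)) x∈C) (trans eq (cong (λ E → p (t E ⟨$⟩ʳ y)) (sym y∈C))))

      unlift : ∀ {x y} → cls x ≡ C → cls y ≡ C → lift x ≡ lift y → p x ≡ p y
      unlift {x} {y} x∈C y∈C lx≡ly =
        subst₂ (λ a a′ → p a ≡ p a′) (inverseˡ (t C)) (inverseˡ (t C))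
          (p-inv (flip (t C)) (has-inv _ (t-∈G C) , t⁻¹-maps C) _ _ (t-maps C x x∈C) (t-maps C y y∈C)
            (trans (cong (λ E → p (t E ⟨$⟩ʳ x)) (sym x∈C))
                   (trans (cong proj₂ lx≡ly) (cong (λ E → p (t E ⟨$⟩ʳ y)) y∈C))))

      conclude : (∀ x y → lift x ≡ lift y → x ≡ y) ⊎ (∀ x y → cls x ≡ cls y → lift x ≡ lift y) →
        (∀ x y → cls x ≡ C → cls y ≡ C → p x ≡ p y → x ≡ y) ⊎ (∀ x y → cls x ≡ C → cls y ≡ C → p x ≡ p y)
      conclude (inj₁ discrete) = inj₁ λ x y x∈C y∈C px≡py →
        discrete x y (lift-≡ x∈C y∈C (p-inv (t C) (t-∈G C , t-maps C) x y x∈C y∈C px≡py))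
      conclude (inj₂ whole) = inj₂ λ x y x∈C y∈C → unlift x∈C y∈C (whole x y (trans x∈C (sym y∈C)))

corollary3p3 : (c d k λ' b : ℕ) → 2 ≤ c → 2 ≤ d →
  (B : Fin b → Subset (c * d)) → IsDesign (c * d) k λ' b B →
  (G : Permutation′ (c * d) → Set) → IsAutSubgroup B G → BlockTransitive B G →
  (cls : Fin (c * d) → Fin d) → ClassSizes cls c → Invariant G cls →
  (C : Fin d) →
  ((∀ i → outerPairs cls (B i) ≡ c) → KPrimitive G cls)
  × ((∀ i → innerPairs cls (B i) ≡ 1) → HPrimitive G cls C)
corollary3p3 c d k λ' b 2≤c 2≤d B design G aut bt cls classSizes cls-inv C =
  K-primitive , H-primitive C
  where open Corollary 2≤c 2≤d design aut bt classSizes cls-inv
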